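{- Let $M$ be a pseudo-model and $U(M)$ its unravelling. For every history $h$ of $M$ and every formula $\varphi\in\mathcal L_D$, $M,\mathrm{last}(h)\models\varphi$ iff $U(M),h\models\varphi$.
   Context: Fix a finite set $A$ of agents and a countable set $\mathsf{AP}$ of atomic propositions. $\mathcal L_D$: $\varphi::=p\mid\neg\varphi\mid\varphi\wedge\varphi\mid D_B\varphi$ with $p\in\mathsf{AP}$, $\emptyset\ne B\subseteq A$. A pseudo-model $M=\langle W,\sim,L\rangle$: a set $W$, a symmetric transitive relation $\sim_B$ on $W$ for each $B\subseteq A$ with (i) $\sim_{B'}\subseteq\sim_B$ for $B\subseteq B'$ and (ii) if $w\sim_Bw$ and $w\sim_{B'}w$ then $w\sim_{B\cup B'}w$; and $L:W\to\mathcal P(\mathsf{AP})$. Satisfaction in $M$: $M,w\models p$ iff $p\in L(w)$, boolean clauses standard, $M,w\models D_B\varphi$ iff $M,w'\models\varphi$ for all $w'$ with $w\sim_Bw'$. A history is $h=(w_0,B_1,w_1,\dots,B_k,w_k)$, $k\ge0$, with $B_i\subseteq A$ and $w_{i-1}\sim_{B_i}w_i$; $\mathrm{last}(h)=w_k$; $h\to_a h'$ iff $h'=(h,B_{k+1},w_{k+1})$ with $a\in B_{k+1}$. The unravelling $U(M)$ is the partial epistemic model whose worlds are histories, with $\sim^u_a$ the transitive closure of $\to_a\cup\leftarrow_a$, and labelling $L^u(h)=L(\mathrm{last}(h))$. Satisfaction in $U(M)$: $D_B\varphi$ holds at $h$ iff $\varphi$ holds at every $h'$ with $h\sim^u_a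 h'$ for all $a\in B$; other clauses standard. -}

module Defs where

open import Data.Nat using (ℕ)
open import Data.Fin using (Fin)
open import Data.Fin.Subset using (Subset; _⊆_; _∪_; _∈_; Nonempty)
open import Data.Product using (Σ; ∃; ∃-syntax; _×_; proj₁)
open import Data.Sum using (_⊎_)
open import Data.Unit using (⊤)
open import Relation.Nullary using (¬_)
open import Relation.Binary.PropositionalEquality using (_≡_)
open import Relation.Binary.Construct.Closure.Transitive using (TransClosure)

AP : Set
AP = ℕ

data Form (n : ℕ) : Set where
  atom : AP → Form n
  ¬'_  : Form n → Form n
  _∧'_ : Form n → Form n → Form n
  D    : (B : Subset n) → Nonempty B → Form n → Form n

record PseudoModel (n : ℕ) : Set₁ where
  field
    W     : Set
    R     : Subset n → W → W → Set
    sym   : ∀ B {w w'} → R B w w' → R B w' w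
    trans : ∀ B {w w' w''} → R B w w' → R B w' w'' → R B w w''
    anti  : ∀ {B B'} → B ⊆ B' → ∀ {w w'} → R B' w w' → R B w w'
    union : ∀ B B' {w} → R B w w → R B' w w → R (B ∪ B') w w
    L     : W → AP → Set

module _ {n : ℕ} (M : PseudoModel n) where
  open PseudoModel M

  _⊨_ : W → Form n → Set
  w ⊨ atom p = L w p
  w ⊨ (¬' φ) = ¬ (w ⊨ φ)
  w ⊨ (φ ∧' ψ) = (w ⊨ φ) × (w ⊨ ψ)
  w ⊨ D B _ φ = ∀ w' → R B w w' → w' ⊨ φ

  -- Finite sequences (w0, B1, w1, ..., Bk, wk), as snoc-lists.
  data Seq : Set where
    start : W → Seq
    _▸_,_ : Seq → Subset n → W → Seq

  last : Seq → W
  last (start w) = w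
  last (s ▸ B , w) = w

  Valid : Seq → Set
  Valid (start w) = ⊤
  Valid (s ▸ B , w) = Valid s × R B (last s) w

  History : Set
  History = Σ Seq Valid

  lastH : History → W
  lastH h = last (proj₁ h)

  Step : Fin n → History → History → Set
  Step a h h' = ∃[ B ] ∃[ w ] (a ∈ B × proj₁ h' ≡ (proj₁ h ▸ B , w))

  Ru : Fin n → History → History → Set
  Ru a = TransClosure (λ h h' → Step a h h' ⊎ Step a h' h)

  -- Satisfaction in the unravelling U(M) (labelling L^u(h) = L(last h)).
  _⊨U_ : History → Form n → Set
  h ⊨U atom p = L (lastH h) p
  h ⊨U (¬' φ) = ¬ (h ⊨U φ)
  h ⊨U (φ ∧' ψ) = (h ⊨U φ) × (h ⊨U ψ)
  h ⊨U D B _ φ = ∀ h' → (∀ a → a ∈ B → Ru a h h') → h' ⊨U φ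

module Submission where

-- The unravelling is a tree: h ∼ᵘ_a h′ holds exactly when h and h′ descend from
-- a common prefix along edges whose agent sets contain a. Prefixes of a history
-- are linearly ordered, so of two such common prefixes the deeper one serves
-- both agents; doing this for every a ∈ B yields a single common prefix u whose
-- edges towards h and h′ are all labelled by supersets of B. By (i) each such
-- edge is a ∼_B step, so last(h) ∼_B last(u) ∼_B last(h′). Conversely, every
-- w ∼_B last(h) is the last world of the child (h, B, w) of h.

open import Defs
open import Data.Nat using (ℕ; suc; _≤_)
open import Data.Nat.Properties using (≤-refl; ≤-trans; m≤n⇒m≤1+n; 1+n≰n)
open import Data.Fin using (Fin)
open import Data.Fin.Subset using (Subset; _⊆_; _∪_; _∈_; Nonempty)
open import Data.Fin.Subset.Properties using (_∈?_; ⊆-refl; ⊆-trans; p⊆p∪q; q⊆p∪q)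
open import Data.List using (List; []; _∷_; allFin)
open import Data.List.Relation.Unary.Any using (here; there)
import Data.List.Membership.Propositional as List
open import Data.List.Membership.Propositional.Properties using (∈-allFin)
open import Data.Product using (∃-syntax; _×_; proj₁; proj₂; _,_) renaming (swap to ×-swap)
open import Data.Sum using (_⊎_; inj₁; inj₂; swap)
open import Data.Unit using (⊤; tt)
open import Data.Empty using (⊥; ⊥-elim)
open import Function.Bundles using (_⇔_; mk⇔; Equivalence)
open Equivalence using (to; from)
open import Function.Properties.Equivalence using () renaming (refl to ⇔-refl)
open import Function.Related.TypeIsomorphisms using (¬-cong-⇔)
open import Data.Product.Function.NonDependent.Propositional using (_×-⇔_)
open import Relation.Nullary using (yes; no)
open import Relation.Binary.PropositionalEquality using (refl)
open import Relation.Binary.Construct.Closure.Transitive using ([_]; _∷_)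
import Relation.Binary.Construct.Closure.Transitive as Plus

module _ {n : ℕ} (X : (Subset n → Set) → Set)
         (X-mono : ∀ {P Q} → (∀ {C} → P C → Q C) → X P → X Q)
         (X-× : ∀ {P Q} → X P → X Q → X (λ C → P C × Q C)) where

  all-agents-⊆ : ∀ {B} → Nonempty B → (∀ {a} → a ∈ B → X (a ∈_)) → X (B ⊆_)
  all-agents-⊆ {B} (a₀ , a₀∈B) Xₐ = X-mono (λ q {a} → q (∈-allFin a)) (upTo (allFin n))
    where
    upTo : (as : List (Fin n)) → X (λ C → ∀ {a} → a List.∈ as → a ∈ B → a ∈ C)
    upTo []       = X-mono (λ _ ()) (Xₐ a₀∈B)
    upTo (a ∷ as) with a ∈? B
    ... | no a∉B = X-mono (λ { q (here refl) a∈B → ⊥-elim (a∉B a∈B) ; q (there i) → q i }) (upTo as)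
    ... | yes a∈B = X-mono (λ { (q , a∈C) (here refl) _ → a∈C ; (q , _) (there i) → q i })
                           (X-× (upTo as) (Xₐ a∈B))

module _ {n : ℕ} (M : PseudoModel n) where
  open PseudoModel M

  data Extension (Q : Subset n → Set) : Seq M → Seq M → Set where
    ε   : ∀ {s} → Extension Q s s
    _▹_ : ∀ {u s B w} → Extension Q u s → Q B → Extension Q u (s ▸ B , w)

  Prefix : Seq M → Seq M → Set
  Prefix = Extension (λ _ → ⊤)

  length : Seq M → ℕ
  length (start _)   = 0
  length (s ▸ _ , _) = suc (length s)

  extension-mono : ∀ {P Q u s} → (∀ {B} → P B → Q B) → Extension P u s → Extension Q u s
  extension-mono f ε       = ε
  extension-mono f (e ▹ q) = extension-mono f e ▹ f q

  extension⇒prefix : ∀ {Q u s} → Extension Q u s → Prefix u s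
  extension⇒prefix = extension-mono (λ _ → tt)

  extension-trans : ∀ {Q u v s} → Extension Q u v → Extension Q v s → Extension Q u s
  extension-trans e ε        = e
  extension-trans e (e′ ▹ q) = extension-trans e e′ ▹ q

  prefix⇒length≤ : ∀ {u s} → Prefix u s → length u ≤ length s
  prefix⇒length≤ ε       = ≤-refl
  prefix⇒length≤ (p ▹ _) = m≤n⇒m≤1+n (prefix⇒length≤ p)

  prefix-acyclic : ∀ {s B w v} → Prefix (s ▸ B , w) v → Prefix v s → ⊥
  prefix-acyclic p q = 1+n≰n (≤-trans (prefix⇒length≤ p) (prefix⇒length≤ q))

  prefix-total : ∀ {u₁ u₂ s} → Prefix u₁ s → Prefix u₂ s → Prefix u₁ u₂ ⊎ Prefix u₂ u₁
  prefix-total ε        p₂       = inj₂ p₂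
  prefix-total (p₁ ▹ t) ε        = inj₁ (p₁ ▹ t)
  prefix-total (p₁ ▹ _) (p₂ ▹ _) = prefix-total p₁ p₂

  extension-split : ∀ {Q u v s} → Extension Q u s → Prefix u v → Prefix v s →
                    Extension Q u v × Extension Q v s
  extension-split e       _   ε        = e , ε
  extension-split ε       puv (pvs ▹ _) = ⊥-elim (prefix-acyclic puv pvs)
  extension-split (e ▹ q) puv (pvs ▹ _) =
    let e₁ , e₂ = extension-split e puv pvs in e₁ , e₂ ▹ q

  extension-× : ∀ {P Q u s} → Extension P u s → Extension Q u s → Extension (λ B → P B × Q B) u s
  extension-× ε        ε        = ε
  extension-× ε        (e ▹ _)  = ⊥-elim (prefix-acyclic (extension⇒prefix e) ε)
  extension-× (e ▹ _)  ε        = ⊥-elim (prefix-acyclic (extension⇒prefix e) ε)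
  extension-× (e ▹ p)  (e′ ▹ q) = extension-× e e′ ▹ (p , q)

  Joined : (Subset n → Set) → Seq M → Seq M → Set
  Joined Q s t = ∃[ u ] (Extension Q u s × Extension Q u t)

  joined-mono : ∀ {P Q s t} → (∀ {B} → P B → Q B) → Joined P s t → Joined Q s t
  joined-mono f (u , eₛ , eₜ) = u , extension-mono f eₛ , extension-mono f eₜ

  joined-sym : ∀ {Q s t} → Joined Q s t → Joined Q t s
  joined-sym (u , eₛ , eₜ) = u , eₜ , eₛ

  joined-trans : ∀ {Q s m t} → Joined Q s m → Joined Q m t → Joined Q s t
  joined-trans (u₁ , e₁ₛ , e₁ₘ) (u₂ , e₂ₘ , e₂ₜ)
    with prefix-total (extension⇒prefix e₁ₘ) (extension⇒prefix e₂ₘ)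
  ... | inj₁ p₁₂ =
    u₁ , e₁ₛ , extension-trans (proj₁ (extension-split e₁ₘ p₁₂ (extension⇒prefix e₂ₘ))) e₂ₜ
  ... | inj₂ p₂₁ =
    u₂ , extension-trans (proj₁ (extension-split e₂ₘ p₂₁ (extension⇒prefix e₁ₘ))) e₁ₛ , e₂ₜ

  extension-×-deeper : ∀ {P Q u₁ u₂ s} → Extension P u₁ s → Prefix u₁ u₂ → Extension Q u₂ s →
                       Extension (λ B → P B × Q B) u₂ s
  extension-×-deeper e p e′ = extension-× (proj₂ (extension-split e p (extension⇒prefix e′))) e′

  joined-× : ∀ {P Q s t} → Joined P s t → Joined Q s t → Joined (λ B → P B × Q B) s t
  joined-× (u₁ , e₁ₛ , e₁ₜ) (u₂ , e₂ₛ , e₂ₜ)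
    with prefix-total (extension⇒prefix e₁ₛ) (extension⇒prefix e₂ₛ)
  ... | inj₁ p₁₂ = u₂ , extension-×-deeper e₁ₛ p₁₂ e₂ₛ , extension-×-deeper e₁ₜ p₁₂ e₂ₜ
  ... | inj₂ p₂₁ =
    joined-mono ×-swap (u₁ , extension-×-deeper e₂ₛ p₂₁ e₁ₛ , extension-×-deeper e₂ₜ p₂₁ e₁ₜ)

  step⇒joined : ∀ {a h h′} → Step M a h h′ → Joined (a ∈_) (proj₁ h) (proj₁ h′)
  step⇒joined {h′ = ._ , _} (_ , _ , a∈B , refl) = _ , ε , ε ▹ a∈B

  edge⇒joined : ∀ {a h h′} → Step M a h h′ ⊎ Step M a h′ h → Joined (a ∈_) (proj₁ h) (proj₁ h′)
  edge⇒joined {h = h} {h′} (inj₁ st) = step⇒joined {h = h} {h′} st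
  edge⇒joined {h = h} {h′} (inj₂ st) = joined-sym (step⇒joined {h = h′} {h} st)

  Ru⇒joined : ∀ {a h h′} → Ru M a h h′ → Joined (a ∈_) (proj₁ h) (proj₁ h′)
  Ru⇒joined {h = h} {h′} [ st ]                 = edge⇒joined {h = h} {h′} st
  Ru⇒joined {h = h} (_∷_ {y = m} st path) = joined-trans (edge⇒joined {h = h} {m} st) (Ru⇒joined path)

  step⇒related : ∀ {a h h′} → Step M a h h′ → ∃[ C ] (a ∈ C × R C (lastH M h) (lastH M h′))
  step⇒related {h′ = ._ , (_ , r)} (B , _ , a∈B , refl) = B , a∈B , r

  edge⇒reflexive : ∀ {a h h′} → Step M a h h′ ⊎ Step M a h′ h →
                   ∃[ C ] (a ∈ C × R C (lastH M h) (lastH M h))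
  edge⇒reflexive {h = h} {h′} (inj₁ st) =
    let C , a∈C , r = step⇒related {h = h} {h′} st in C , a∈C , trans C r (sym C r)
  edge⇒reflexive {h = h} {h′} (inj₂ st) =
    let C , a∈C , r = step⇒related {h = h′} {h} st in C , a∈C , trans C (sym C r) r

  Ru⇒reflexive : ∀ {a h h′} → Ru M a h h′ → ∃[ C ] (a ∈ C × R C (lastH M h) (lastH M h))
  Ru⇒reflexive {h = h} {h′} [ st ]             = edge⇒reflexive {h = h} {h′} st
  Ru⇒reflexive {h = h} (_∷_ {y = m} st _) = edge⇒reflexive {h = h} {m} st

  -- This is where axiom (ii) of pseudo-models is needed: when h = h′ the
  -- unravelling relates h to itself, and M must then have w ∼_B w.
  reflexive-distributed : ∀ {B w} → Nonempty B → (∀ {a} → a ∈ B → ∃[ C ] (a ∈ C × R C w w)) → R B w w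
  reflexive-distributed {B} {w} ne reflₐ =
    let C , r , B⊆C = all-agents-⊆ ReflexiveBelow mono both ne single in anti (B⊆C ⊆-refl) r
    where
    ReflexiveBelow : (Subset n → Set) → Set
    ReflexiveBelow Q = ∃[ C ] (R C w w × (∀ {D} → C ⊆ D → Q D))

    mono : ∀ {P Q} → (∀ {C} → P C → Q C) → ReflexiveBelow P → ReflexiveBelow Q
    mono f (C , r , p) = C , r , λ C⊆D → f (p C⊆D)

    both : ∀ {P Q} → ReflexiveBelow P → ReflexiveBelow Q → ReflexiveBelow (λ C → P C × Q C)
    both (C₁ , r₁ , p) (C₂ , r₂ , q) =
      C₁ ∪ C₂ , union C₁ C₂ r₁ r₂ ,
      λ C⊆D → p (⊆-trans (p⊆p∪q C₂) C⊆D) , q (⊆-trans (q⊆p∪q C₁ C₂) C⊆D)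

    single : ∀ {a} → a ∈ B → ReflexiveBelow (a ∈_)
    single a∈B = let C , a∈C , r = reflₐ a∈B in C , r , λ C⊆D → C⊆D a∈C

  extension⇒related : ∀ {B u s} → Valid M s → Extension (B ⊆_) u s →
                      R B (last M s) (last M s) → R B (last M u) (last M s)
  extension⇒related _       ε          r = r
  extension⇒related (v , r) (e ▹ B⊆C) _ =
    let r′ = anti B⊆C r in trans _ (extension⇒related v e (trans _ r′ (sym _ r′))) r′

  Ru-all⇒R : ∀ {B h h′} → Nonempty B → (∀ a → a ∈ B → Ru M a h h′) → R B (lastH M h) (lastH M h′)
  Ru-all⇒R {B} {s , vₛ} {t , vₜ} ne ru =
    let _ , eₛ , eₜ = joined
    in  trans B (sym B (extension⇒related vₛ eₛ rₛ)) (extension⇒related vₜ eₜ rₜ)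
    where
    joined : Joined (B ⊆_) s t
    joined = all-agents-⊆ (λ Q → Joined Q s t) joined-mono joined-× ne
                          (λ a∈B → Ru⇒joined (ru _ a∈B))
    rₛ = reflexive-distributed ne (λ a∈B → Ru⇒reflexive (ru _ a∈B))
    rₜ = reflexive-distributed ne (λ a∈B → Ru⇒reflexive (Plus.symmetric _ swap (ru _ a∈B)))

lemma40 : ∀ {n : ℕ} (M : PseudoModel n) (h : History M) (φ : Form n) →
            (_⊨_ M (lastH M h) φ) ⇔ (_⊨U_ M h φ)
lemma40 M h (atom p)    = ⇔-refl
lemma40 M h (¬' φ)      = ¬-cong-⇔ (lemma40 M h φ)
lemma40 M h (φ ∧' ψ)    = lemma40 M h φ ×-⇔ lemma40 M h ψ
lemma40 M h (D B ne φ) = mk⇔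
  (λ Dφ h′ ru → to (lemma40 M h′ φ) (Dφ (lastH M h′) (Ru-all⇒R M ne ru)))
  (λ Dφ w r → from (lemma40 M ((proj₁ h ▸ B , w) , (proj₂ h , r)) φ)
                   (Dφ _ (λ a a∈B → [ inj₁ (B , w , a∈B , refl) ])))
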